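{- Let $q \in \mathbb{C}$ with $q \neq 0$ and $q$ not a root of unity. Let $f, p \in \mathbb{C}[[x]]$ be formal power series with $f_{.0} = 0$ and $f_{.1} = 1$, satisfying Poincar\'{e}'s functional equation $$f \circ (q x) = p \circ f .$$ (This forces $p_{.0}=0$ and $p_{.1}=q$, so all compositional iterates $p^{\circ i}$ are defined, with $p^{\circ 0} = x$.) Let $j \geqslant 1$ and let $g_j \in \mathbb{C}[x]$ be an arbitrary nonzero polynomial of $q$-difference order $j$, i.e. $g_j(q^m) = 0$ for all integers $0 \leqslant m < j$ and $g_j(q^j) \neq 0$. Then $$f_{.j} = \frac{1}{g_j(q^j)} \sum_{i \geqslant 0} g_{j.i}\, (p^{\circ i})_{.j} .$$
   Context: For a formal power series (or polynomial) $h$, $h_{.j}$ denotes the coefficient of $x^j$ in $h$; thus $g_{j.i}$ is the coefficient of $x^i$ in the polynomial $g_j$, and $(p^{\circ i})_{.j}$ is the coefficient of $x^j$ in the $i$-fold compositional iterate $p^{\circ i} = p \circ \cdots \circ p$ ($i$ times), with $p^{\circ 0} = x$ the identity series. Composition $h \circ k$ of formal power series is defined when $k_{.0}=0$ by $(h\circ k)_{.j} = \sum_{0 \le l \le j} h_{.l} (k^l)_{.j}$. The "$q$-difference order" of a nonzero polynomial $g$ is the smallest nonnegative integer $n$ with $g(q^n) \neq 0$. -}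

module Defs where

open import Level using (_⊔_)
open import Data.Nat as ℕ using (ℕ; zero; suc)
open import Data.List using (List; []; _∷_; length)
open import Data.Product using (Σ; ∃; _×_)
open import Relation.Nullary using (¬_)
open import Algebra.Bundles using (CommutativeRing)

-- A field, presented as a commutative ring with 1 ≉ 0 and inverses of
-- nonzero elements (agda-stdlib has no Field bundle).
record IsField {c ℓ} (R : CommutativeRing c ℓ) : Set (c ⊔ ℓ) where
  open CommutativeRing R
  field
    1≉0   : ¬ (1# ≈ 0#)
    inv   : (x : Carrier) → ¬ (x ≈ 0#) → Carrier
    inv-r : (x : Carrier) (nz : ¬ (x ≈ 0#)) → x * inv x nz ≈ 1#

module FPS {c ℓ} (R : CommutativeRing c ℓ) where
  open CommutativeRing R

  -- formal power series: h n is the coefficient h_{.n}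
  Series : Set c
  Series = ℕ → Carrier

  sumTo : ℕ → (ℕ → Carrier) → Carrier
  sumTo zero    h = 0#
  sumTo (suc n) h = sumTo n h + h n

  pow : Carrier → ℕ → Carrier
  pow a zero    = 1#
  pow a (suc n) = a * pow a n

  one : Series
  one zero    = 1#
  one (suc _) = 0#

  X : Series
  X (suc zero) = 1#
  X _          = 0#

  scaleX : Carrier → Series
  scaleX q (suc zero) = q
  scaleX q _          = 0#

  mul : Series → Series → Series
  mul h k n = sumTo (suc n) (λ l → h l * k (n ℕ.∸ l))

  spow : Series → ℕ → Series
  spow h zero    = one
  spow h (suc l) = mul h (spow h l)

  -- composition (h ∘ k)_{.j} = Σ_{0 ≤ l ≤ j} h_{.l} (k^l)_{.j}  (used when k_{.0} = 0)
  comp : Series → Series → Series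
  comp h k j = sumTo (suc j) (λ l → h l * spow k l j)

  iter : Series → ℕ → Series
  iter p zero    = X
  iter p (suc i) = comp p (iter p i)

  -- polynomials as coefficient lists (constant term first)
  Poly : Set c
  Poly = List Carrier

  coeff : Poly → ℕ → Carrier
  coeff []       _       = 0#
  coeff (a ∷ g)  zero    = a
  coeff (a ∷ g)  (suc i) = coeff g i

  eval : Poly → Carrier → Carrier
  eval []      a = 0#
  eval (b ∷ g) a = b + a * eval g a

  NonzeroPoly : Poly → Set ℓ
  NonzeroPoly g = ∃ λ i → ¬ (coeff g i ≈ 0#)

  HasQDiffOrder : Carrier → Poly → ℕ → Set ℓ
  HasQDiffOrder q g j = (∀ m → m ℕ.< j → eval g (pow q m) ≈ 0#) × ¬ (eval g (pow q j) ≈ 0#)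

  RootOfUnity : Carrier → Set ℓ
  RootOfUnity q = ∃ λ n → pow q (suc n) ≈ 1#

-- Put P = Σᵢ gᵢ p^{∘i} (iterSum p g). Iterating the functional equation gives p^{∘i} ∘ f = f ∘ (qⁱx),
-- so P ∘ f has coefficients (P ∘ f)_{.n} = f_{.n} g(qⁿ). Since f_{.0} = 0 and f_{.1} = 1,
-- (P ∘ f)_{.n} = P_{.n} whenever the lower coefficients of P vanish; as g(qᵐ) = 0 for m < j,
-- induction makes P_{.0}, …, P_{.j-1} vanish, and then P_{.j} = f_{.j} g(qʲ).
module Submission where

open import Defs
open import Data.Nat using (ℕ; zero; suc; _∸_; _≤_; _<_; z≤n; s≤s; s≤s⁻¹; _≤?_)
import Data.Nat as ℕ
open import Data.Nat.Properties
  using (m<n⇒m<1+n; n<1+n; ≤-antisym; ≰⇒>; n∸n≡0; +-∸-assoc; m∸n≤m; ∸-+-assoc; m+[n∸m]≡n;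
         ≤-trans; <-trans; <⇒≤; +-monoʳ-≤; m≤m+n)
open import Data.Nat.Induction using (<-rec)
open import Data.Product using (proj₂; _,_)
open import Data.List using ([]; _∷_; length)
open import Relation.Nullary using (¬_; yes; no)
import Relation.Binary.PropositionalEquality as ≡
open import Algebra.Bundles using (CommutativeRing)

module SeriesProperties {c ℓ} (R : CommutativeRing c ℓ) where
  open CommutativeRing R
  open FPS R
  open import Relation.Binary.Reasoning.Setoid setoid
  open import Algebra.Properties.CommutativeSemigroup +-commutativeSemigroup
    using () renaming (interchange to +-interchange)
  open import Algebra.Properties.CommutativeSemigroup *-commutativeSemigroup
    using () renaming (interchange to *-interchange; x∙yz≈y∙xz to x*yz≈y*xz)

  pow-cong : ∀ {a b} → a ≈ b → ∀ n → pow a n ≈ pow b n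
  pow-cong e zero    = refl
  pow-cong e (suc n) = *-cong e (pow-cong e n)

  pow-1# : ∀ n → pow 1# n ≈ 1#
  pow-1# zero    = refl
  pow-1# (suc n) = trans (*-identityˡ _) (pow-1# n)

  pow-distrib-* : ∀ a b n → pow (a * b) n ≈ pow a n * pow b n
  pow-distrib-* a b zero    = sym (*-identityˡ 1#)
  pow-distrib-* a b (suc n) = trans (*-congˡ (pow-distrib-* a b n)) (*-interchange _ _ _ _)

  pow-pow-comm : ∀ a i n → pow (pow a i) n ≈ pow (pow a n) i
  pow-pow-comm a zero    n = pow-1# n
  pow-pow-comm a (suc i) n = trans (pow-distrib-* a (pow a i) n) (*-congˡ (pow-pow-comm a i n))

  sumTo-cong-< : ∀ n {h k : ℕ → Carrier} → (∀ i → i < n → h i ≈ k i) → sumTo n h ≈ sumTo n k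
  sumTo-cong-< zero    e = refl
  sumTo-cong-< (suc n) e = +-cong (sumTo-cong-< n (λ i i<n → e i (m<n⇒m<1+n i<n))) (e n (n<1+n n))

  sumTo-cong : ∀ n {h k : ℕ → Carrier} → (∀ i → h i ≈ k i) → sumTo n h ≈ sumTo n k
  sumTo-cong n e = sumTo-cong-< n (λ i _ → e i)

  sumTo-0# : ∀ n {h : ℕ → Carrier} → (∀ i → i < n → h i ≈ 0#) → sumTo n h ≈ 0#
  sumTo-0# zero    e = refl
  sumTo-0# (suc n) e =
    trans (+-cong (sumTo-0# n (λ i i<n → e i (m<n⇒m<1+n i<n))) (e n (n<1+n n))) (+-identityʳ 0#)

  sumTo-+ : ∀ n (h k : ℕ → Carrier) → sumTo n (λ i → h i + k i) ≈ sumTo n h + sumTo n k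
  sumTo-+ zero    h k = sym (+-identityʳ 0#)
  sumTo-+ (suc n) h k = trans (+-congʳ (sumTo-+ n h k)) (+-interchange _ _ _ _)

  *-distribˡ-sumTo : ∀ n a (h : ℕ → Carrier) → a * sumTo n h ≈ sumTo n (λ i → a * h i)
  *-distribˡ-sumTo zero    a h = zeroʳ a
  *-distribˡ-sumTo (suc n) a h = trans (distribˡ a _ _) (+-congʳ (*-distribˡ-sumTo n a h))

  *-distribʳ-sumTo : ∀ n a (h : ℕ → Carrier) → sumTo n h * a ≈ sumTo n (λ i → h i * a)
  *-distribʳ-sumTo zero    a h = zeroˡ a
  *-distribʳ-sumTo (suc n) a h = trans (distribʳ a _ _) (+-congʳ (*-distribʳ-sumTo n a h))

  sumTo-comm : ∀ n m (h : ℕ → ℕ → Carrier) →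
               sumTo n (λ i → sumTo m (h i)) ≈ sumTo m (λ k → sumTo n (λ i → h i k))
  sumTo-comm zero    m h = sym (sumTo-0# m (λ _ _ → refl))
  sumTo-comm (suc n) m h = trans (+-congʳ (sumTo-comm n m h)) (sym (sumTo-+ m _ _))

  sumTo-extend : ∀ {n m} (h : ℕ → Carrier) → n ≤ m → (∀ i → n ≤ i → i < m → h i ≈ 0#) →
                 sumTo m h ≈ sumTo n h
  sumTo-extend {n} {zero}  h z≤n e = refl
  sumTo-extend {n} {suc m} h n≤1+m e with n ≤? m
  ... | yes n≤m = trans (+-cong (sumTo-extend h n≤m (λ i n≤i i<m → e i n≤i (m<n⇒m<1+n i<m)))
                                (e m n≤m (n<1+n m)))
                        (+-identityʳ _)
  ... | no  n≰m rewrite ≤-antisym n≤1+m (≰⇒> n≰m) = refl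

  sumTo-suc : ∀ n (h : ℕ → Carrier) → sumTo (suc n) h ≈ h 0 + sumTo n (λ i → h (suc i))
  sumTo-suc zero    h = +-comm 0# (h 0)
  sumTo-suc (suc n) h = trans (+-congʳ (sumTo-suc n h)) (+-assoc _ _ _)

  sumTo-triangle : ∀ N (F : ℕ → ℕ → Carrier) →
                   sumTo N (λ l → sumTo (suc l) (λ s → F s (l ∸ s))) ≈ sumTo N (λ s → sumTo (N ∸ s) (F s))
  sumTo-triangle zero    F = refl
  sumTo-triangle (suc N) F = begin
      sumTo N (λ l → sumTo (suc l) (λ s → F s (l ∸ s))) + sumTo (suc N) (λ s → F s (N ∸ s))
    ≈⟨ +-congʳ (sumTo-triangle N F) ⟩
      sumTo N (λ s → sumTo (N ∸ s) (F s)) + sumTo (suc N) (λ s → F s (N ∸ s))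
    ≈⟨ +-congʳ (sym (trans (+-congˡ empty) (+-identityʳ _))) ⟩
      sumTo (suc N) (λ s → sumTo (N ∸ s) (F s)) + sumTo (suc N) (λ s → F s (N ∸ s))
    ≈⟨ sym (sumTo-+ (suc N) _ _) ⟩
      sumTo (suc N) (λ s → sumTo (N ∸ s) (F s) + F s (N ∸ s))
    ≈⟨ sumTo-cong-< (suc N) row ⟩
      sumTo (suc N) (λ s → sumTo (suc N ∸ s) (F s)) ∎
    where
    empty : sumTo (N ∸ N) (F N) ≈ 0#
    empty rewrite n∸n≡0 N = refl
    row : ∀ s → s < suc N → sumTo (N ∸ s) (F s) + F s (N ∸ s) ≈ sumTo (suc N ∸ s) (F s)
    row s s<1+N rewrite +-∸-assoc 1 (s≤s⁻¹ s<1+N) = refl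

  mul-cong-≤ : ∀ n {A A′ B B′ : Series} → (∀ t → t ≤ n → A t ≈ A′ t) → (∀ t → t ≤ n → B t ≈ B′ t) →
               mul A B n ≈ mul A′ B′ n
  mul-cong-≤ n eA eB = sumTo-cong-< (suc n) (λ t t<1+n → *-cong (eA t (s≤s⁻¹ t<1+n)) (eB (n ∸ t) (m∸n≤m n t)))

  mul-cong : ∀ {A A′ B B′ : Series} → (∀ t → A t ≈ A′ t) → (∀ t → B t ≈ B′ t) → ∀ n → mul A B n ≈ mul A′ B′ n
  mul-cong eA eB n = mul-cong-≤ n (λ t _ → eA t) (λ t _ → eB t)

  mul-identityˡ : ∀ (B : Series) n → mul one B n ≈ B n
  mul-identityˡ B n =
    trans (sumTo-suc n _) (trans (+-cong (*-identityˡ (B n)) (sumTo-0# n (λ _ _ → zeroˡ _))) (+-identityʳ _))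

  mul-identityʳ : ∀ (A : Series) n → mul A one n ≈ A n
  mul-identityʳ A n = trans (+-cong (sumTo-0# n off-diagonal) (trans (*-congˡ diagonal) (*-identityʳ (A n))))
                            (+-identityˡ _)
    where
    off-diagonal : ∀ l → l < n → A l * one (n ∸ l) ≈ 0#
    off-diagonal l (s≤s l<n) rewrite +-∸-assoc 1 l<n = zeroʳ _
    diagonal : one (n ∸ n) ≈ 1#
    diagonal rewrite n∸n≡0 n = refl

  mul-assoc : ∀ (A B C : Series) n → mul (mul A B) C n ≈ mul A (mul B C) n
  mul-assoc A B C n = begin
      sumTo (suc n) (λ x → sumTo (suc x) (λ u → A u * B (x ∸ u)) * C (n ∸ x))
    ≈⟨ sumTo-cong (suc n) (λ x → *-distribʳ-sumTo (suc x) _ _) ⟩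
      sumTo (suc n) (λ x → sumTo (suc x) (λ u → A u * B (x ∸ u) * C (n ∸ x)))
    ≈⟨ sumTo-cong (suc n) (λ x → sumTo-cong-< (suc x) (λ u u<1+x → reindex x u (s≤s⁻¹ u<1+x))) ⟩
      sumTo (suc n) (λ x → sumTo (suc x) (λ u → F u (x ∸ u)))
    ≈⟨ sumTo-triangle (suc n) F ⟩
      sumTo (suc n) (λ u → sumTo (suc n ∸ u) (F u))
    ≈⟨ sumTo-cong-< (suc n) (λ u u<1+n → inner u (s≤s⁻¹ u<1+n)) ⟩
      sumTo (suc n) (λ u → sumTo (suc (n ∸ u)) (λ v → A u * (B v * C (n ∸ u ∸ v))))
    ≈⟨ sumTo-cong (suc n) (λ u → sym (*-distribˡ-sumTo (suc (n ∸ u)) (A u) _)) ⟩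
      sumTo (suc n) (λ u → A u * sumTo (suc (n ∸ u)) (λ v → B v * C (n ∸ u ∸ v))) ∎
    where
    F : ℕ → ℕ → Carrier
    F u v = A u * (B v * C (n ∸ (u ℕ.+ v)))
    reindex : ∀ x u → u ≤ x → A u * B (x ∸ u) * C (n ∸ x) ≈ F u (x ∸ u)
    reindex x u u≤x rewrite m+[n∸m]≡n u≤x = *-assoc _ _ _
    inner : ∀ u → u ≤ n → sumTo (suc n ∸ u) (F u) ≈ sumTo (suc (n ∸ u)) (λ v → A u * (B v * C (n ∸ u ∸ v)))
    inner u u≤n rewrite +-∸-assoc 1 u≤n =
      sumTo-cong (suc (n ∸ u)) (λ v → ≡.subst (λ w → F u v ≈ A u * (B v * C w)) (≡.sym (∸-+-assoc n u v)) refl)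

  mul-distribʳ-sumTo : ∀ N (A : ℕ → Series) (B : Series) n →
                       mul (λ t → sumTo N (λ s → A s t)) B n ≈ sumTo N (λ s → mul (A s) B n)
  mul-distribʳ-sumTo N A B n = trans (sumTo-cong (suc n) (λ t → *-distribʳ-sumTo N _ _)) (sumTo-comm (suc n) N _)

  mul-distribˡ-sumTo : ∀ N (A : Series) (B : ℕ → Series) n →
                       mul A (λ t → sumTo N (λ s → B s t)) n ≈ sumTo N (λ s → mul A (B s) n)
  mul-distribˡ-sumTo N A B n = trans (sumTo-cong (suc n) (λ t → *-distribˡ-sumTo N _ _)) (sumTo-comm (suc n) N _)

  mul-scaleˡ : ∀ a (A B : Series) n → mul (λ t → a * A t) B n ≈ a * mul A B n
  mul-scaleˡ a A B n = trans (sumTo-cong (suc n) (λ t → *-assoc _ _ _)) (sym (*-distribˡ-sumTo (suc n) a _))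

  mul-scaleʳ : ∀ a (A B : Series) n → mul A (λ t → a * B t) n ≈ a * mul A B n
  mul-scaleʳ a A B n = trans (sumTo-cong (suc n) (λ t → x*yz≈y*xz _ _ _)) (sym (*-distribˡ-sumTo (suc n) a _))

  spow-cong : ∀ {k k′ : Series} → (∀ t → k t ≈ k′ t) → ∀ l n → spow k l n ≈ spow k′ l n
  spow-cong e zero    n = refl
  spow-cong e (suc l) n = mul-cong e (spow-cong e l) n

  spow-+ : ∀ (m : Series) s r n → spow m (s ℕ.+ r) n ≈ mul (spow m s) (spow m r) n
  spow-+ m zero    r n = sym (mul-identityˡ (spow m r) n)
  spow-+ m (suc s) r n =
    trans (mul-cong (λ _ → refl) (spow-+ m s r) n) (sym (mul-assoc m (spow m s) (spow m r) n))

  spow-below : ∀ (m : Series) → m 0 ≈ 0# → ∀ l n → n < l → spow m l n ≈ 0#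
  spow-below m m0 (suc l) n n<1+l = sumTo-0# (suc n) (term n n<1+l)
    where
    term : ∀ n → n < suc l → ∀ t → t < suc n → m t * spow m l (n ∸ t) ≈ 0#
    term n _ zero _ = trans (*-congʳ m0) (zeroˡ _)
    term zero _ (suc t) (s≤s ())
    term (suc n) (s≤s n<l) (suc t) _ =
      trans (*-congˡ (spow-below m m0 l (n ∸ t) (≤-trans (s≤s (m∸n≤m n t)) n<l))) (zeroʳ _)

  spow-diagonal : ∀ (m : Series) → m 0 ≈ 0# → ∀ l → spow m l l ≈ pow (m 1) l
  spow-diagonal m m0 zero    = refl
  spow-diagonal m m0 (suc l) = begin
      sumTo (suc (suc l)) (λ t → m t * spow m l (suc l ∸ t))
    ≈⟨ sumTo-suc (suc l) _ ⟩
      m 0 * spow m l (suc l) + sumTo (suc l) (λ t → m (suc t) * spow m l (l ∸ t))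
    ≈⟨ +-cong (trans (*-congʳ m0) (zeroˡ _)) (sumTo-suc l _) ⟩
      0# + (m 1 * spow m l l + sumTo l (λ t → m (suc (suc t)) * spow m l (l ∸ suc t)))
    ≈⟨ +-identityˡ _ ⟩
      m 1 * spow m l l + sumTo l (λ t → m (suc (suc t)) * spow m l (l ∸ suc t))
    ≈⟨ +-cong (*-congˡ (spow-diagonal m m0 l)) (sumTo-0# l tail) ⟩
      m 1 * pow (m 1) l + 0#
    ≈⟨ +-identityʳ _ ⟩
      m 1 * pow (m 1) l ∎
    where
    tail : ∀ t → t < l → m (suc (suc t)) * spow m l (l ∸ suc t) ≈ 0#
    tail t t<l = trans (*-congˡ (spow-below m m0 l (l ∸ suc t) (∸-monoʳ-< t<l))) (zeroʳ _)
      where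
      ∸-monoʳ-< : t < l → l ∸ suc t < l
      ∸-monoʳ-< (s≤s _) = s≤s (m∸n≤m _ t)

  spow-scaleX-above : ∀ a l n → l < n → spow (scaleX a) l n ≈ 0#
  spow-scaleX-above a zero    (suc n) _     = refl
  spow-scaleX-above a (suc l) n       l+1<n = sumTo-0# (suc n) (term n l+1<n)
    where
    term : ∀ n → suc l < n → ∀ t → t < suc n → scaleX a t * spow (scaleX a) l (n ∸ t) ≈ 0#
    term n _ zero _ = zeroˡ _
    term (suc n) (s≤s l<n) (suc zero) _ = trans (*-congˡ (spow-scaleX-above a l n l<n)) (zeroʳ _)
    term n _ (suc (suc t)) _ = zeroˡ _

  eval-sumTo : ∀ (g : Poly) a → eval g a ≈ sumTo (length g) (λ i → coeff g i * pow a i)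
  eval-sumTo []      a = refl
  eval-sumTo (b ∷ g) a = begin
      b + a * eval g a
    ≈⟨ +-cong (sym (*-identityʳ b)) (*-congˡ (eval-sumTo g a)) ⟩
      b * 1# + a * sumTo (length g) (λ i → coeff g i * pow a i)
    ≈⟨ +-congˡ (trans (*-distribˡ-sumTo (length g) a _) (sumTo-cong (length g) (λ i → x*yz≈y*xz _ _ _))) ⟩
      b * 1# + sumTo (length g) (λ i → coeff g i * (a * pow a i))
    ≈⟨ sym (sumTo-suc (length g) _) ⟩
      sumTo (suc (length g)) (λ i → coeff (b ∷ g) i * pow a i) ∎

  comp-truncate : ∀ (u m : Series) → m 0 ≈ 0# → ∀ n t → t ≤ n →
                  comp u m t ≈ sumTo (suc n) (λ s → u s * spow m s t)
  comp-truncate u m m0 n t t≤n =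
    sym (sumTo-extend _ (s≤s t≤n) (λ i t<i _ → trans (*-congˡ (spow-below m m0 i t t<i)) (zeroʳ _)))

  comp-congʳ : ∀ (a : Series) {k k′ : Series} → (∀ t → k t ≈ k′ t) → ∀ n → comp a k n ≈ comp a k′ n
  comp-congʳ a e n = sumTo-cong (suc n) (λ l → *-congˡ (spow-cong e l n))

  comp-one : ∀ (m : Series) n → comp one m n ≈ one n
  comp-one m n =
    trans (sumTo-suc n _) (trans (+-cong (*-identityˡ _) (sumTo-0# n (λ _ _ → zeroˡ _))) (+-identityʳ _))

  comp-X : ∀ (f : Series) → f 0 ≈ 0# → ∀ n → comp X f n ≈ f n
  comp-X f f0 zero    = trans (+-identityˡ _) (trans (zeroˡ _) (sym f0))
  comp-X f f0 (suc n) = begin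
      comp X f (suc n)
    ≈⟨ sumTo-suc (suc n) _ ⟩
      0# * spow f 0 (suc n) + sumTo (suc n) (λ l → X (suc l) * spow f (suc l) (suc n))
    ≈⟨ +-cong (zeroˡ _) (sumTo-suc n _) ⟩
      0# + (1# * spow f 1 (suc n) + sumTo n (λ l → 0# * spow f (suc (suc l)) (suc n)))
    ≈⟨ trans (+-identityˡ _) (+-cong (*-identityˡ _) (sumTo-0# n (λ _ _ → zeroˡ _))) ⟩
      spow f 1 (suc n) + 0#
    ≈⟨ trans (+-identityʳ _) (mul-identityʳ f (suc n)) ⟩
      f (suc n) ∎

  comp-scaleX : ∀ (h : Series) a n → comp h (scaleX a) n ≈ h n * pow a n
  comp-scaleX h a n =
    trans (+-cong (sumTo-0# n (λ l l<n → trans (*-congˡ (spow-scaleX-above a l n l<n)) (zeroʳ _)))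
                  (*-congˡ (spow-diagonal (scaleX a) refl n)))
          (+-identityˡ _)

  comp-mul : ∀ (m : Series) → m 0 ≈ 0# → ∀ (u v : Series) n → comp (mul u v) m n ≈ mul (comp u m) (comp v m) n
  comp-mul m m0 u v n = begin
      sumTo N (λ l → sumTo (suc l) (λ s → u s * v (l ∸ s)) * spow m l n)
    ≈⟨ sumTo-cong N (λ l → *-distribʳ-sumTo (suc l) _ _) ⟩
      sumTo N (λ l → sumTo (suc l) (λ s → u s * v (l ∸ s) * spow m l n))
    ≈⟨ sumTo-cong N (λ l → sumTo-cong-< (suc l) (λ s s<1+l → reindex l s (s≤s⁻¹ s<1+l))) ⟩
      sumTo N (λ l → sumTo (suc l) (λ s → G s (l ∸ s)))
    ≈⟨ sumTo-triangle N G ⟩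
      sumTo N (λ s → sumTo (N ∸ s) (G s))
    ≈⟨ sumTo-cong N (λ s → sym (sumTo-extend _ (m∸n≤m N s) (λ r N∸s≤r _ → G-high s r N∸s≤r))) ⟩
      sumTo N (λ s → sumTo N (λ r → u s * (v r * spow m (s ℕ.+ r) n)))
    ≈⟨ sumTo-cong N (λ s → sym (*-distribˡ-sumTo N (u s) _)) ⟩
      sumTo N (λ s → u s * sumTo N (λ r → v r * spow m (s ℕ.+ r) n))
    ≈⟨ sumTo-cong N (λ s → *-congˡ (sumTo-cong N (λ r → *-congˡ (spow-+ m s r n)))) ⟩
      sumTo N (λ s → u s * sumTo N (λ r → v r * mul (spow m s) (spow m r) n))
    ≈⟨ sumTo-cong N (λ s → *-congˡ (sumTo-cong N (λ r → sym (mul-scaleʳ (v r) (spow m s) (spow m r) n)))) ⟩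
      sumTo N (λ s → u s * sumTo N (λ r → mul (spow m s) (V r) n))
    ≈⟨ sumTo-cong N (λ s → *-congˡ (sym (mul-distribˡ-sumTo N (spow m s) V n))) ⟩
      sumTo N (λ s → u s * mul (spow m s) (λ t → sumTo N (λ r → V r t)) n)
    ≈⟨ sumTo-cong N (λ s → sym (mul-scaleˡ (u s) (spow m s) (λ t → sumTo N (λ r → V r t)) n)) ⟩
      sumTo N (λ s → mul (U s) (λ t → sumTo N (λ r → V r t)) n)
    ≈⟨ sym (mul-distribʳ-sumTo N U (λ t → sumTo N (λ r → V r t)) n) ⟩
      mul (λ t → sumTo N (λ s → U s t)) (λ t → sumTo N (λ r → V r t)) n
    ≈⟨ sym (mul-cong-≤ n (comp-truncate u m m0 n) (comp-truncate v m m0 n)) ⟩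
      mul (comp u m) (comp v m) n ∎
    where
    N = suc n
    U V : ℕ → Series
    U s t = u s * spow m s t
    V r t = v r * spow m r t
    G : ℕ → ℕ → Carrier
    G s r = u s * (v r * spow m (s ℕ.+ r) n)
    reindex : ∀ l s → s ≤ l → u s * v (l ∸ s) * spow m l n ≈ G s (l ∸ s)
    reindex l s s≤l rewrite m+[n∸m]≡n s≤l = *-assoc _ _ _
    n<s+r : ∀ s r → N ∸ s ≤ r → n < s ℕ.+ r
    n<s+r s r N∸s≤r with s ≤? N
    ... | yes s≤N = ≡.subst (_≤ s ℕ.+ r) (m+[n∸m]≡n s≤N) (+-monoʳ-≤ s N∸s≤r)
    ... | no  s≰N = ≤-trans (<⇒≤ (≰⇒> s≰N)) (m≤m+n s r)
    G-high : ∀ s r → N ∸ s ≤ r → G s r ≈ 0#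
    G-high s r N∸s≤r =
      trans (*-congˡ (trans (*-congˡ (spow-below m m0 (s ℕ.+ r) n (n<s+r s r N∸s≤r))) (zeroʳ _))) (zeroʳ _)

  comp-spow : ∀ (m : Series) → m 0 ≈ 0# → ∀ (b : Series) l n → comp (spow b l) m n ≈ spow (comp b m) l n
  comp-spow m m0 b zero    n = comp-one m n
  comp-spow m m0 b (suc l) n =
    trans (comp-mul m m0 b (spow b l) n) (mul-cong (λ _ → refl) (comp-spow m m0 b l) n)

  comp-assoc : ∀ (a b m : Series) → b 0 ≈ 0# → m 0 ≈ 0# → ∀ n → comp (comp a b) m n ≈ comp a (comp b m) n
  comp-assoc a b m b0 m0 n = begin
      sumTo N (λ r → sumTo (suc r) (λ l → a l * spow b l r) * spow m r n)
    ≈⟨ sumTo-cong-< N (λ r r<N → *-congʳ (comp-truncate a b b0 n r (s≤s⁻¹ r<N))) ⟩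
      sumTo N (λ r → sumTo N (λ l → a l * spow b l r) * spow m r n)
    ≈⟨ sumTo-cong N (λ r → *-distribʳ-sumTo N _ _) ⟩
      sumTo N (λ r → sumTo N (λ l → a l * spow b l r * spow m r n))
    ≈⟨ sumTo-comm N N _ ⟩
      sumTo N (λ l → sumTo N (λ r → a l * spow b l r * spow m r n))
    ≈⟨ sumTo-cong N (λ l → trans (sumTo-cong N (λ r → *-assoc _ _ _)) (sym (*-distribˡ-sumTo N (a l) _))) ⟩
      sumTo N (λ l → a l * comp (spow b l) m n)
    ≈⟨ sumTo-cong N (λ l → *-congˡ (comp-spow m m0 b l n)) ⟩
      sumTo N (λ l → a l * spow (comp b m) l n) ∎
    where
    N = suc n

  comp-lowest : ∀ (h f : Series) → f 0 ≈ 0# → f 1 ≈ 1# → ∀ l → (∀ k → k < l → h k ≈ 0#) → comp h f l ≈ h l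
  comp-lowest h f f0 f1 l h-low =
    trans (+-cong (sumTo-0# l (λ k k<l → trans (*-congʳ (h-low k k<l)) (zeroˡ _))) (*-congˡ f-diagonal))
          (trans (+-identityˡ _) (*-identityʳ _))
    where
    f-diagonal : spow f l l ≈ 1#
    f-diagonal = trans (spow-diagonal f f0 l) (trans (pow-cong f1 l) (pow-1# l))

module FieldProperties {c ℓ} (R : CommutativeRing c ℓ) (F : IsField R) where
  open CommutativeRing R
  open IsField F
  open import Relation.Binary.Reasoning.Setoid setoid

  x*y≈z⇒x≈y⁻¹*z : ∀ {x y z} (y≉0 : ¬ (y ≈ 0#)) → x * y ≈ z → x ≈ inv y y≉0 * z
  x*y≈z⇒x≈y⁻¹*z {x} {y} {z} y≉0 x*y≈z = begin
    x                   ≈⟨ sym (*-identityʳ x) ⟩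
    x * 1#              ≈⟨ *-congˡ (sym (inv-r y y≉0)) ⟩
    x * (y * inv y y≉0) ≈⟨ sym (*-assoc x y _) ⟩
    x * y * inv y y≉0   ≈⟨ *-comm _ _ ⟩
    inv y y≉0 * (x * y) ≈⟨ *-congˡ x*y≈z ⟩
    inv y y≉0 * z       ∎

module PoincareEquation {c ℓ} (R : CommutativeRing c ℓ) where
  open CommutativeRing R
  open FPS R
  open SeriesProperties R
  open import Relation.Binary.Reasoning.Setoid setoid
  open import Algebra.Properties.CommutativeSemigroup *-commutativeSemigroup
    using () renaming (x∙yz≈y∙xz to x*yz≈y*xz)

  iterSum : Series → Poly → Series
  iterSum p g l = sumTo (length g) (λ i → coeff g i * iter p i l)

  module _ (q : Carrier) (f p : Series) (f0 : f 0 ≈ 0#) (f1 : f 1 ≈ 1#)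
           (poincaré : ∀ n → comp f (scaleX q) n ≈ comp p f n) where

    p-0 : p 0 ≈ 0#
    p-0 = begin
      p 0                 ≈⟨ sym (trans (+-identityˡ _) (*-identityʳ _)) ⟩
      comp p f 0          ≈⟨ sym (poincaré 0) ⟩
      comp f (scaleX q) 0 ≈⟨ trans (+-identityˡ _) (trans (*-identityʳ _) f0) ⟩
      0#                  ∎

    iter-0 : ∀ i → iter p i 0 ≈ 0#
    iter-0 zero    = refl
    iter-0 (suc i) = trans (+-identityˡ _) (trans (*-identityʳ _) p-0)

    comp-iter : ∀ i n → comp (iter p i) f n ≈ f n * pow (pow q i) n
    comp-iter zero    n = trans (comp-X f f0 n) (trans (sym (*-identityʳ _)) (*-congˡ (sym (pow-1# n))))
    comp-iter (suc i) n = begin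
        comp (comp p (iter p i)) f n
      ≈⟨ comp-assoc p (iter p i) f (iter-0 i) f0 n ⟩
        comp p (comp (iter p i) f) n
      ≈⟨ comp-congʳ p (λ k → trans (comp-iter i k) (sym (comp-scaleX f qⁱ k))) n ⟩
        comp p (comp f (scaleX qⁱ)) n
      ≈⟨ sym (comp-assoc p f (scaleX qⁱ) f0 refl n) ⟩
        comp (comp p f) (scaleX qⁱ) n
      ≈⟨ comp-scaleX (comp p f) qⁱ n ⟩
        comp p f n * pow qⁱ n
      ≈⟨ *-congʳ (trans (sym (poincaré n)) (comp-scaleX f q n)) ⟩
        f n * pow q n * pow qⁱ n
      ≈⟨ trans (*-assoc _ _ _) (*-congˡ (sym (pow-distrib-* q qⁱ n))) ⟩
        f n * pow (q * qⁱ) n ∎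
      where qⁱ = pow q i

    comp-iterSum : ∀ g n → comp (iterSum p g) f n ≈ f n * eval g (pow q n)
    comp-iterSum g n = begin
        sumTo N (λ l → iterSum p g l * spow f l n)
      ≈⟨ sumTo-cong N (λ l → *-distribʳ-sumTo L _ _) ⟩
        sumTo N (λ l → sumTo L (λ i → coeff g i * iter p i l * spow f l n))
      ≈⟨ sumTo-comm N L _ ⟩
        sumTo L (λ i → sumTo N (λ l → coeff g i * iter p i l * spow f l n))
      ≈⟨ sumTo-cong L (λ i → trans (sumTo-cong N (λ l → *-assoc _ _ _)) (sym (*-distribˡ-sumTo N (coeff g i) _))) ⟩
        sumTo L (λ i → coeff g i * comp (iter p i) f n)
      ≈⟨ sumTo-cong L (λ i → trans (*-congˡ (comp-iter i n))
                                   (trans (x*yz≈y*xz _ _ _) (*-congˡ (*-congˡ (pow-pow-comm q i n))))) ⟩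
        sumTo L (λ i → f n * (coeff g i * pow (pow q n) i))
      ≈⟨ sym (*-distribˡ-sumTo L (f n) _) ⟩
        f n * sumTo L (λ i → coeff g i * pow (pow q n) i)
      ≈⟨ *-congˡ (sym (eval-sumTo g (pow q n))) ⟩
        f n * eval g (pow q n) ∎
      where
      N = suc n
      L = length g

    module _ (g : Poly) (j : ℕ) (g-roots : ∀ m → m < j → eval g (pow q m) ≈ 0#) where

      iterSum-below : ∀ k → k < j → iterSum p g k ≈ 0#
      iterSum-below = <-rec (λ k → k < j → iterSum p g k ≈ 0#) step
        where
        step : ∀ k → (∀ {k′} → k′ < k → k′ < j → iterSum p g k′ ≈ 0#) → k < j → iterSum p g k ≈ 0#
        step k ih k<j = begin
          iterSum p g k                ≈⟨ sym (comp-lowest _ f f0 f1 k (λ _ k′<k → ih k′<k (<-trans k′<k k<j))) ⟩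
          comp (iterSum p g) f k       ≈⟨ comp-iterSum g k ⟩
          f k * eval g (pow q k)       ≈⟨ trans (*-congˡ (g-roots k k<j)) (zeroʳ _) ⟩
          0#                           ∎

      iterSum-order : iterSum p g j ≈ f j * eval g (pow q j)
      iterSum-order = trans (sym (comp-lowest _ f f0 f1 j iterSum-below)) (comp-iterSum g j)

open PoincareEquation using (iterSum-order)
open FieldProperties using (x*y≈z⇒x≈y⁻¹*z)

mainTheorem1 : ∀ {c ℓ} (R : CommutativeRing c ℓ) (F : IsField R) →
    let open CommutativeRing R
        open IsField F
        open FPS R
    in (q : Carrier) → ¬ (q ≈ 0#) → ¬ RootOfUnity q →
       (f p : Series) → f 0 ≈ 0# → f 1 ≈ 1# →
       (∀ n → comp f (scaleX q) n ≈ comp p f n) →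
       (j : ℕ) → 1 ≤ j →
       (g : Poly) → NonzeroPoly g → (ord : HasQDiffOrder q g j) →
       f j ≈ inv (eval g (pow q j)) (proj₂ ord) * sumTo (length g) (λ i → coeff g i * iter p i j)
mainTheorem1 R F q _ _ f p f0 f1 poincaré j _ g _ (g-roots , g[qʲ]≉0) =
  x*y≈z⇒x≈y⁻¹*z R F g[qʲ]≉0 (CommutativeRing.sym R (iterSum-order R q f p f0 f1 poincaré g j g-roots))
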